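{- Let $d\ge 1$ be an integer. For an integer base $b\ge 2$ and $k\ge 1$, let $N_k=b^{2^k}-1$. Then there exist infinitely many bases $b\ge 2$ such that, for every $k\ge 1$ and every integer $i$ with $1\le i\le d$, $N_k$ is a degree $i$ $b$-Niven number.
   Context: For an integer base $b\ge 2$ and a positive integer $N$, let $s_b(N)$ denote the sum of the base $b$ digits of $N$. A positive integer $N$ is a $b$-Niven number if $s_b(N)$ divides $N$. For an integer $m\ge 1$, a positive integer $N$ is a degree $m$ $b$-Niven number if both $N$ and $N^m$ are $b$-Niven numbers. -}

module Defs where

open import Data.Nat using (ℕ; zero; suc; _+_; _*_; _∸_; _^_; _≤_; NonZero)
open import Data.Nat.DivMod using (_/_; _%_)
open import Data.Nat.Divisibility using (_∣_)
open import Data.Product using (_×_)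

-- digit sum in base (suc (suc c)), computed with fuel; fuel ≥ n suffices
-- since n / b < n for n > 0.
digitSumFuel : ℕ → ℕ → ℕ → ℕ
digitSumFuel c zero n = 0
digitSumFuel c (suc fuel) zero = 0
digitSumFuel c (suc fuel) n@(suc _) =
  n % suc (suc c) + digitSumFuel c fuel (n / suc (suc c))

-- s_b(N): sum of base-b digits of N (for b ≥ 2; b = 2 + c).
-- For b < 2 it is set to 0 (never used: statements require b ≥ 2).
digitSum : ℕ → ℕ → ℕ
digitSum (suc (suc c)) n = digitSumFuel c n n
digitSum _ n = 0

IsNiven : ℕ → ℕ → Set
IsNiven b N = 1 ≤ N × digitSum b N ∣ N

IsNivenDeg : ℕ → ℕ → ℕ → Set
IsNivenDeg m b N = IsNiven b N × IsNiven b (N ^ m)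

module Submission where

-- Put B = bⁿ (n = 2^k), Y = B - 1 = Nₖ and W = n(b-1) = s_b(Y).  By the
-- binomial theorem Yⁱ is the alternating sum Σⱼ ±C(i,j) Bʲ with top sign +.
-- If all C(i,j) ≤ 2ⁱ are base-b digits, pairing each positive term with the
-- negative term below it, a Bʲ⁺¹ - c Bʲ = (a-1) Bʲ⁺¹ + (B-c) Bʲ, yields the
-- base-B blocks of Yⁱ; they contribute a-1 and W-(c-1) to the digit sum.
-- As the alternating sum of a Pascal row vanishes, s_b(Yⁱ) = u·W with
-- u ≤ i+1 the number of negative terms.  For b - 1 = 2e with (d+1)! ∣ e, u
-- divides b - 1, and (1+2e)^(2^k) ≡ 1 (mod 2^k·2e) gives W ∣ Y; so
-- s_b(Y) = W ∣ Y and u·W ∣ W·W ∣ Yⁱ for i ≥ 2.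

open import Defs
open import Data.Nat using (ℕ; zero; suc; pred; _+_; _*_; _∸_; _^_; _!; _≤_; _<_; z≤n; s≤s; s≤s⁻¹; >-nonZero)
open import Data.Nat.Properties
open import Data.Nat.DivMod using (_/_; _%_; m≡m%n+[m/n]*n; [m+kn]%n≡m%n; m<n⇒m%n≡m; m%n<n; m/n<m; m<n⇒m/n≡0; m*n/n≡m; +-distrib-/-∣ʳ; m<n*o⇒m/o<n)
open import Data.Nat.Divisibility using (_∣_; divides; ∣-trans; m∣m*n; n∣m*n; *-pres-∣; *-monoʳ-∣; *-monoˡ-∣; m≤n⇒m!∣n!)
open import Data.Nat.Tactic.RingSolver using (solve-∀)
open import Data.Product using (Σ; _×_; _,_; proj₁; proj₂)
open import Data.Sum using (_⊎_; inj₁; inj₂; swap; [_,_]′)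
open import Data.List using (List; []; _∷_; length)
open import Data.List.Relation.Unary.All as All using (All; []; _∷_)
open import Data.Unit using (⊤; tt)
open import Data.Empty using (⊥)
open import Relation.Binary.PropositionalEquality using (_≡_; refl; sym; trans; cong; cong₂; subst; module ≡-Reasoning)

module DigitSum (c : ℕ) where

  b : ℕ
  b = suc (suc c)

  S : ℕ → ℕ
  S = digitSum b

  quotient-smaller : ∀ x → suc x / b ≤ x
  quotient-smaller x = <⇒≤pred (m/n<m (suc x) b (s≤s (s≤s z≤n)))

  fuel-irrelevant : ∀ f g x → x ≤ f → x ≤ g → digitSumFuel c f x ≡ digitSumFuel c g x
  fuel-irrelevant zero zero zero _ _ = refl
  fuel-irrelevant zero (suc g) zero _ _ = refl
  fuel-irrelevant (suc f) zero zero _ _ = refl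
  fuel-irrelevant (suc f) (suc g) zero _ _ = refl
  fuel-irrelevant (suc f) (suc g) (suc x) (s≤s x≤f) (s≤s x≤g) =
    cong (suc x % b +_) (fuel-irrelevant f g (suc x / b)
      (≤-trans (quotient-smaller x) x≤f) (≤-trans (quotient-smaller x) x≤g))

  digitSum-unfold : ∀ x → S x ≡ x % b + S (x / b)
  digitSum-unfold zero = refl
  digitSum-unfold (suc x) = cong (suc x % b +_)
    (fuel-irrelevant x (suc x / b) (suc x / b) (quotient-smaller x) ≤-refl)

  digitSum-digit : ∀ r q → r < b → S (r + q * b) ≡ r + S q
  digitSum-digit r q r<b = trans (digitSum-unfold (r + q * b)) (cong₂ _+_ last-digit (cong S quotient))
    where
      open ≡-Reasoning
      last-digit : (r + q * b) % b ≡ r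
      last-digit = trans ([m+kn]%n≡m%n r q b) (m<n⇒m%n≡m r<b)
      quotient : (r + q * b) / b ≡ q
      quotient = begin
        (r + q * b) / b     ≡⟨ +-distrib-/-∣ʳ r (n∣m*n q) ⟩
        r / b + q * b / b   ≡⟨ cong₂ _+_ (m<n⇒m/n≡0 r<b) (m*n/n≡m q b) ⟩
        q                   ∎

  digitSum-single : ∀ r → r < b → S r ≡ r
  digitSum-single r r<b = begin
      S r           ≡⟨ cong S (sym (+-identityʳ r)) ⟩
      S (r + 0 * b) ≡⟨ digitSum-digit r 0 r<b ⟩
      r + 0         ≡⟨ +-identityʳ r ⟩
      r             ∎
    where open ≡-Reasoning

  digitSum-concat : ∀ L x y → x < b ^ L → S (x + y * b ^ L) ≡ S x + S y
  digitSum-concat zero zero y _ = cong S (*-identityʳ y)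
  digitSum-concat zero (suc x) y (s≤s ())
  digitSum-concat (suc L) x y x<bL = begin
      S (x + y * (b * b ^ L))         ≡⟨ cong S regroup ⟩
      S (r + (q + y * b ^ L) * b)     ≡⟨ digitSum-digit r (q + y * b ^ L) r<b ⟩
      r + S (q + y * b ^ L)           ≡⟨ cong (r +_) (digitSum-concat L q y q<bL) ⟩
      r + (S q + S y)                 ≡⟨ sym (+-assoc r (S q) (S y)) ⟩
      r + S q + S y                   ≡⟨ cong (_+ S y) (sym (digitSum-unfold x)) ⟩
      S x + S y                       ∎
    where
      open ≡-Reasoning
      r q : ℕ
      r = x % b
      q = x / b
      r<b : r < b
      r<b = m%n<n x b
      q<bL : q < b ^ L
      q<bL = m<n*o⇒m/o<n (subst (x <_) (*-comm b (b ^ L)) x<bL)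
      shuffle : ∀ r q y b P → r + q * b + y * (b * P) ≡ r + (q + y * P) * b
      shuffle = solve-∀
      regroup : x + y * (b * b ^ L) ≡ r + (q + y * b ^ L) * b
      regroup = trans (cong (_+ y * (b * b ^ L)) (m≡m%n+[m/n]*n x b)) (shuffle r q y b (b ^ L))

  -- If x + y = b^L - 1 then x and y have complementary digits, each pair
  -- summing to b - 1.
  digitSum-complement : ∀ L x y → suc (x + y) ≡ b ^ L → S x + S y ≡ L * suc c
  digitSum-complement zero zero zero _ = refl
  digitSum-complement (suc L) x y complementary = begin
      S x + S y                               ≡⟨ cong₂ _+_ (cong S (m≡m%n+[m/n]*n x b)) (cong S y-split) ⟩
      S (r + q * b) + S (r' + q' * b)         ≡⟨ cong₂ _+_ (digitSum-digit r q r<b) (digitSum-digit r' q' r'<b) ⟩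
      (r + S q) + (r' + S q')                 ≡⟨ interchange r (S q) r' (S q') ⟩
      (r + r') + (S q + S q')                 ≡⟨ cong₂ _+_ (suc-injective digit-pair) (digitSum-complement L q q' rest-pair) ⟩
      suc c + L * suc c                       ∎
    where
      open ≡-Reasoning
      r q r' q' : ℕ
      r = x % b
      q = x / b
      r<b : r < b
      r<b = m%n<n x b
      q<bL : q < b ^ L
      q<bL = m<n*o⇒m/o<n (subst (x <_) (trans complementary (*-comm b (b ^ L))) (s≤s (m≤m+n x y)))
      r' = b ∸ suc r
      q' = b ^ L ∸ suc q
      digit-pair : suc r + r' ≡ b
      digit-pair = m+[n∸m]≡n r<b
      rest-pair : suc (q + q') ≡ b ^ L
      rest-pair = m+[n∸m]≡n q<bL
      r'<b : r' < b
      r'<b = subst (r' <_) digit-pair (s≤s (m≤n+m r' r))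
      interchange : ∀ a b c d → (a + b) + (c + d) ≡ (a + c) + (b + d)
      interchange = solve-∀
      regroup : ∀ r r' q q' b → suc r + r' + (q + q') * b ≡ suc (r + q * b) + (r' + q' * b)
      regroup = solve-∀
      y-split : y ≡ r' + q' * b
      y-split = +-cancelˡ-≡ (suc x) y (r' + q' * b) (begin
        suc x + y                         ≡⟨ complementary ⟩
        b * b ^ L                         ≡⟨ cong (b *_) (sym rest-pair) ⟩
        b * suc (q + q')                  ≡⟨ *-comm b (suc (q + q')) ⟩
        b + (q + q') * b                  ≡⟨ cong (_+ (q + q') * b) (sym digit-pair) ⟩
        suc r + r' + (q + q') * b         ≡⟨ regroup r r' q q' b ⟩
        suc (r + q * b) + (r' + q' * b)   ≡⟨ cong (λ t → suc t + (r' + q' * b)) (sym (m≡m%n+[m/n]*n x b)) ⟩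
        suc x + (r' + q' * b)             ∎)

Even Odd : ℕ → Set
Even zero    = ⊤
Even (suc n) = Odd n
Odd  zero    = ⊥
Odd  (suc n) = Even n

parity : ∀ n → Even n ⊎ Odd n
parity zero    = inj₁ tt
parity (suc n) = swap (parity n)

Bounded : ℕ → ℕ → Set
Bounded m x = 1 ≤ x × x ≤ m

Bounded-mono : ∀ {m m' x} → m ≤ m' → Bounded m x → Bounded m' x
Bounded-mono m≤m' (1≤x , x≤m) = 1≤x , ≤-trans x≤m m≤m'

-- A list x₀ ∷ x₁ ∷ … holds the coefficients at positions 0, 1, ….
evenPart oddPart : ℕ → List ℕ → ℕ
evenPart B []      = 0
evenPart B (x ∷ r) = x + oddPart B r * B
oddPart  B []      = 0
oddPart  B (x ∷ r) = evenPart B r * B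

evenSum oddSum : List ℕ → ℕ
evenSum []      = 0
evenSum (x ∷ r) = x + oddSum r
oddSum  []      = 0
oddSum  (x ∷ r) = evenSum r

evenCount oddCount : List ℕ → ℕ
evenCount []      = 0
evenCount (x ∷ r) = suc (oddCount r)
oddCount  []      = 0
oddCount  (x ∷ r) = evenCount r

counts≤length : ∀ l → evenCount l ≤ length l × oddCount l ≤ length l
counts≤length []      = z≤n , z≤n
counts≤length (x ∷ r) = s≤s (proj₂ (counts≤length r)) , m≤n⇒m≤1+n (proj₁ (counts≤length r))

counts-bounded : ∀ l → 2 ≤ length l → Bounded (length l) (evenCount l) × Bounded (length l) (oddCount l)
counts-bounded (x ∷ []) (s≤s ())
counts-bounded (x ∷ y ∷ r) _ = (s≤s z≤n , proj₁ (counts≤length (x ∷ y ∷ r))) , (s≤s z≤n , proj₂ (counts≤length (x ∷ y ∷ r)))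

-- Base-B expansions of an alternating sum of coefficients with top sign +.
-- expandPos l: the lowest coefficient enters with sign +;
-- expandNeg l: it enters with sign -, so B is borrowed from the next block;
-- expandBorrow l: it enters with sign + but has lent 1 to the block below.
module Expansion (B : ℕ) where

  expandPos expandNeg expandBorrow : List ℕ → ℕ
  expandPos    []      = 0
  expandPos    (x ∷ r) = x + expandNeg r * B
  expandNeg    []      = 0
  expandNeg    (x ∷ r) = (B ∸ x) + expandBorrow r * B
  expandBorrow []      = 0
  expandBorrow (x ∷ r) = (x ∸ 1) + expandNeg r * B

  expandBorrow-value : ∀ l → Odd (length l) → All (Bounded B) l → suc (expandBorrow l + oddPart B l) ≡ evenPart B l
  expandNeg-value : ∀ l → Even (length l) → All (Bounded B) l → expandNeg l + evenPart B l ≡ oddPart B l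

  expandBorrow-value (x ∷ r) even ((1≤x , _) ∷ bounded) = begin
      suc (x ∸ 1 + expandNeg r * B + evenPart B r * B)   ≡⟨ cong suc (+-assoc (x ∸ 1) _ _) ⟩
      suc (x ∸ 1 + (expandNeg r * B + evenPart B r * B)) ≡⟨ cong (λ t → suc (x ∸ 1 + t)) (sym (*-distribʳ-+ B (expandNeg r) _)) ⟩
      suc (x ∸ 1 + (expandNeg r + evenPart B r) * B)     ≡⟨ cong (λ t → suc (x ∸ 1) + t * B) (expandNeg-value r even bounded) ⟩
      suc (x ∸ 1) + oddPart B r * B                      ≡⟨ cong (_+ oddPart B r * B) (suc-pred x {{>-nonZero 1≤x}}) ⟩
      x + oddPart B r * B                                ∎
    where open ≡-Reasoning
  expandNeg-value []      _   _ = refl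
  expandNeg-value (x ∷ r) odd ((_ , x≤B) ∷ bounded) = begin
      B ∸ x + expandBorrow r * B + (x + oddPart B r * B)   ≡⟨ regroup (B ∸ x) (expandBorrow r) B x (oddPart B r) ⟩
      (B ∸ x + x) + (expandBorrow r + oddPart B r) * B     ≡⟨ cong (_+ (expandBorrow r + oddPart B r) * B) (m∸n+n≡m x≤B) ⟩
      suc (expandBorrow r + oddPart B r) * B               ≡⟨ cong (_* B) (expandBorrow-value r odd bounded) ⟩
      evenPart B r * B                                     ∎
    where
      open ≡-Reasoning
      regroup : ∀ a q B x v → a + q * B + (x + v * B) ≡ (a + x) + (q + v) * B
      regroup = solve-∀

  expandPos-value : ∀ l → Odd (length l) → All (Bounded B) l → expandPos l + oddPart B l ≡ evenPart B l
  expandPos-value (x ∷ r) even (_ ∷ bounded) = begin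
      x + expandNeg r * B + evenPart B r * B     ≡⟨ +-assoc x _ _ ⟩
      x + (expandNeg r * B + evenPart B r * B)   ≡⟨ cong (x +_) (sym (*-distribʳ-+ B (expandNeg r) _)) ⟩
      x + (expandNeg r + evenPart B r) * B       ≡⟨ cong (λ t → x + t * B) (expandNeg-value r even bounded) ⟩
      x + oddPart B r * B                        ∎
    where open ≡-Reasoning

-- Digit sums of the expansions in base B = bⁿ (n ≥ 1), when every
-- coefficient is a nonzero base-b digit: each block contributes its
-- coefficient, or W - (coefficient - 1) for a borrowing block.
module BlockDigitSum (c n : ℕ) (n≥1 : 1 ≤ n) where
  open DigitSum c public

  B W : ℕ
  B = b ^ n
  W = n * suc c

  open Expansion B public

  b≤B : b ≤ B
  b≤B = subst (_≤ B) (*-identityʳ b) (^-monoʳ-≤ b n≥1)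

  digit<B : ∀ {x} → x < b → x < B
  digit<B x<b = ≤-trans x<b b≤B

  borrow-block : ∀ x → Bounded (suc c) x → x ∸ 1 + S (B ∸ x) ≡ W
  borrow-block x (1≤x , x≤c+1) = begin
      x ∸ 1 + S (B ∸ x)       ≡⟨ cong (_+ S (B ∸ x)) (sym (digitSum-single (x ∸ 1) (s≤s (≤-trans (m∸n≤m x 1) x≤c+1)))) ⟩
      S (x ∸ 1) + S (B ∸ x)   ≡⟨ digitSum-complement n (x ∸ 1) (B ∸ x) sum-to-B ⟩
      W                       ∎
    where
      open ≡-Reasoning
      sum-to-B : suc (x ∸ 1 + (B ∸ x)) ≡ B
      sum-to-B = trans (cong (_+ (B ∸ x)) (suc-pred x {{>-nonZero 1≤x}})) (m+[n∸m]≡n (<⇒≤ (digit<B (s≤s x≤c+1))))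

  digitSum-expandPos : ∀ l → Odd (length l) → All (Bounded (suc c)) l →
    S (expandPos l) + oddSum l ≡ oddCount l * W + evenSum l
  digitSum-expandBorrow : ∀ l → Odd (length l) → All (Bounded (suc c)) l →
    suc (S (expandBorrow l) + oddSum l) ≡ oddCount l * W + evenSum l
  digitSum-expandNeg : ∀ l → Even (length l) → All (Bounded (suc c)) l →
    S (expandNeg l) + evenSum l ≡ evenCount l * W + oddSum l

  digitSum-expandPos (x ∷ r) even ((_ , x≤c+1) ∷ digits) = begin
      S (x + expandNeg r * B) + evenSum r           ≡⟨ cong (_+ evenSum r) (digitSum-concat n x (expandNeg r) (digit<B (s≤s x≤c+1))) ⟩
      S x + S (expandNeg r) + evenSum r             ≡⟨ cong (λ t → t + S (expandNeg r) + evenSum r) (digitSum-single x (s≤s x≤c+1)) ⟩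
      x + S (expandNeg r) + evenSum r               ≡⟨ +-assoc x _ _ ⟩
      x + (S (expandNeg r) + evenSum r)             ≡⟨ cong (x +_) (digitSum-expandNeg r even digits) ⟩
      x + (evenCount r * W + oddSum r)              ≡⟨ +-comm-front x (evenCount r * W) (oddSum r) ⟩
      evenCount r * W + (x + oddSum r)              ∎
    where
      open ≡-Reasoning
      +-comm-front : ∀ x a s → x + (a + s) ≡ a + (x + s)
      +-comm-front = solve-∀
  digitSum-expandBorrow (x ∷ r) even ((1≤x , x≤c+1) ∷ digits) = begin
      suc (S (x ∸ 1 + expandNeg r * B) + evenSum r) ≡⟨ cong (λ t → suc (t + evenSum r)) (digitSum-concat n (x ∸ 1) (expandNeg r) (digit<B x-1<b)) ⟩
      suc (S (x ∸ 1) + S (expandNeg r) + evenSum r) ≡⟨ cong (λ t → suc (t + S (expandNeg r) + evenSum r)) (digitSum-single (x ∸ 1) x-1<b) ⟩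
      suc (x ∸ 1 + S (expandNeg r) + evenSum r)     ≡⟨ cong suc (+-assoc (x ∸ 1) _ _) ⟩
      suc (x ∸ 1) + (S (expandNeg r) + evenSum r)   ≡⟨ cong₂ _+_ (suc-pred x {{>-nonZero 1≤x}}) (digitSum-expandNeg r even digits) ⟩
      x + (evenCount r * W + oddSum r)              ≡⟨ +-comm-front x (evenCount r * W) (oddSum r) ⟩
      evenCount r * W + (x + oddSum r)              ∎
    where
      open ≡-Reasoning
      x-1<b : x ∸ 1 < b
      x-1<b = s≤s (≤-trans (m∸n≤m x 1) x≤c+1)
      +-comm-front : ∀ x a s → x + (a + s) ≡ a + (x + s)
      +-comm-front = solve-∀
  digitSum-expandNeg []      _   _ = refl
  digitSum-expandNeg (x ∷ r) odd (digit@(1≤x , x≤c+1) ∷ digits) = begin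
      S (B ∸ x + expandBorrow r * B) + (x + oddSum r)           ≡⟨ cong (_+ (x + oddSum r)) (digitSum-concat n (B ∸ x) (expandBorrow r) B-x<B) ⟩
      S (B ∸ x) + S (expandBorrow r) + (x + oddSum r)           ≡⟨ cong (λ t → S (B ∸ x) + S (expandBorrow r) + (t + oddSum r)) (sym (suc-pred x {{>-nonZero 1≤x}})) ⟩
      S (B ∸ x) + S (expandBorrow r) + (suc (x ∸ 1) + oddSum r) ≡⟨ regroup (x ∸ 1) (S (B ∸ x)) (S (expandBorrow r)) (oddSum r) ⟩
      (x ∸ 1 + S (B ∸ x)) + suc (S (expandBorrow r) + oddSum r) ≡⟨ cong₂ _+_ (borrow-block x digit) (digitSum-expandBorrow r odd digits) ⟩
      W + (oddCount r * W + evenSum r)                          ≡⟨ sym (+-assoc W _ _) ⟩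
      suc (oddCount r) * W + evenSum r                          ∎
    where
      open ≡-Reasoning
      B-x<B : B ∸ x < B
      B-x<B = ∸-monoʳ-< {B} {x} {0} 1≤x (<⇒≤ (digit<B (s≤s x≤c+1)))
      regroup : ∀ y u v s → u + v + (suc y + s) ≡ (y + u) + suc (v + s)
      regroup = solve-∀

  c+1≤B : suc c ≤ B
  c+1≤B = ≤-trans (n≤1+n (suc c)) b≤B

  digitSum-alternating⁺ : ∀ N l → Odd (length l) → All (Bounded (suc c)) l → evenSum l ≡ oddSum l →
    evenPart B l ≡ N + oddPart B l → S N ≡ oddCount l * W
  digitSum-alternating⁺ N l odd digits balanced value = +-cancelʳ-≡ (oddSum l) (S N) (oddCount l * W) (begin
      S N + oddSum l              ≡⟨ cong (λ t → S t + oddSum l) N≡expansion ⟩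
      S (expandPos l) + oddSum l  ≡⟨ digitSum-expandPos l odd digits ⟩
      oddCount l * W + evenSum l  ≡⟨ cong (oddCount l * W +_) balanced ⟩
      oddCount l * W + oddSum l   ∎)
    where
      open ≡-Reasoning
      N≡expansion : N ≡ expandPos l
      N≡expansion = +-cancelʳ-≡ (oddPart B l) N (expandPos l)
        (trans (sym value) (sym (expandPos-value l odd (All.map (Bounded-mono c+1≤B) digits))))

  digitSum-alternating⁻ : ∀ N l → Even (length l) → All (Bounded (suc c)) l → evenSum l ≡ oddSum l →
    oddPart B l ≡ N + evenPart B l → S N ≡ evenCount l * W
  digitSum-alternating⁻ N l even digits balanced value = +-cancelʳ-≡ (evenSum l) (S N) (evenCount l * W) (begin
      S N + evenSum l              ≡⟨ cong (λ t → S t + evenSum l) N≡expansion ⟩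
      S (expandNeg l) + evenSum l  ≡⟨ digitSum-expandNeg l even digits ⟩
      evenCount l * W + oddSum l   ≡⟨ cong (evenCount l * W +_) (sym balanced) ⟩
      evenCount l * W + evenSum l  ∎)
    where
      open ≡-Reasoning
      N≡expansion : N ≡ expandNeg l
      N≡expansion = +-cancelʳ-≡ (evenPart B l) N (expandNeg l)
        (trans (sym value) (sym (expandNeg-value l even (All.map (Bounded-mono c+1≤B) digits))))

-- shiftSum p (x₀ ∷ … ∷ xₘ) = (p + x₀) ∷ (x₀ + x₁) ∷ … ∷ (xₘ₋₁ + xₘ) ∷ xₘ,
-- the coefficient list of p + (1 + X)·(x₀ + x₁ X + … + xₘ Xᵐ).
shiftSum : ℕ → List ℕ → List ℕ
shiftSum p []      = p ∷ []
shiftSum p (x ∷ r) = (p + x) ∷ shiftSum x r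

-- Row i of Pascal's triangle, the coefficients of (1 + X)ⁱ.  It starts
-- with 1 by construction, and pascal (suc i) = shiftSum 0 (pascal i)
-- holds by definition.
pascalTail : ℕ → List ℕ
pascalTail zero    = []
pascalTail (suc i) = shiftSum 1 (pascalTail i)

pascal : ℕ → List ℕ
pascal i = 1 ∷ pascalTail i

shiftSum-length : ∀ p r → length (shiftSum p r) ≡ suc (length r)
shiftSum-length p []      = refl
shiftSum-length p (x ∷ r) = cong suc (shiftSum-length x r)

pascal-length : ∀ i → length (pascal i) ≡ suc i
pascal-length zero    = refl
pascal-length (suc i) = trans (shiftSum-length 0 (pascal i)) (cong suc (pascal-length i))

shiftSum-bounded : ∀ {m} p x r → p ≤ m → All (Bounded m) (x ∷ r) → All (Bounded (2 * m)) (shiftSum p (x ∷ r))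
shiftSum-bounded {m} p x [] p≤m ((1≤x , x≤m) ∷ []) =
  (≤-trans 1≤x (m≤n+m x p) , +-mono-≤ p≤m (≤-trans x≤m (m≤m+n m 0))) ∷ (1≤x , ≤-trans x≤m (m≤m+n m _)) ∷ []
shiftSum-bounded {m} p x (y ∷ r) p≤m ((1≤x , x≤m) ∷ bounded) =
  (≤-trans 1≤x (m≤n+m x p) , +-mono-≤ p≤m (≤-trans x≤m (m≤m+n m 0))) ∷ shiftSum-bounded x y r x≤m bounded

pascal-bounded : ∀ i → All (Bounded (2 ^ i)) (pascal i)
pascal-bounded zero    = (≤-refl , ≤-refl) ∷ []
pascal-bounded (suc i) = shiftSum-bounded 0 1 (pascalTail i) z≤n (pascal-bounded i)

shiftSum-sums : ∀ p r → evenSum (shiftSum p r) ≡ p + (evenSum r + oddSum r) × oddSum (shiftSum p r) ≡ evenSum r + oddSum r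
shiftSum-sums p []      = refl , refl
shiftSum-sums p (x ∷ r) = trans (cong (p + x +_) (proj₂ ih)) (trans (+-assoc p x _) (cong (p +_) (regroup x (evenSum r) (oddSum r))))
                        , trans (proj₁ ih) (regroup x (evenSum r) (oddSum r))
  where
    ih : evenSum (shiftSum x r) ≡ x + (evenSum r + oddSum r) × oddSum (shiftSum x r) ≡ evenSum r + oddSum r
    ih = shiftSum-sums x r
    regroup : ∀ x e o → x + (e + o) ≡ x + o + e
    regroup = solve-∀

pascal-balanced : ∀ i → evenSum (pascal (suc i)) ≡ oddSum (pascal (suc i))
pascal-balanced i = trans (proj₁ (shiftSum-sums 0 (pascal i))) (sym (proj₂ (shiftSum-sums 0 (pascal i))))

-- In base B, multiplication by 1 + X becomes multiplication by 1 + B,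
-- exchanging the even and odd parts.
shiftSum-value : ∀ B p r → evenPart B (shiftSum p r) ≡ p + evenPart B r + oddPart B r * B
                         × oddPart B (shiftSum p r) ≡ oddPart B r + evenPart B r * B
shiftSum-value B p []      = sym (+-identityʳ (p + 0)) , refl
shiftSum-value B p (x ∷ r) = trans (cong (λ t → p + x + t * B) (proj₂ ih)) (regroup-even p x (oddPart B r) (evenPart B r) B)
                           , trans (cong (_* B) (proj₁ ih)) (regroup-odd x (evenPart B r) (oddPart B r) B)
  where
    ih : evenPart B (shiftSum x r) ≡ x + evenPart B r + oddPart B r * B × oddPart B (shiftSum x r) ≡ oddPart B r + evenPart B r * B
    ih = shiftSum-value B x r
    regroup-even : ∀ p x o e B → p + x + (o + e * B) * B ≡ p + (x + o * B) + e * B * B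
    regroup-even = solve-∀
    regroup-odd : ∀ x e o B → (x + e + o * B) * B ≡ e * B + (x + o * B) * B
    regroup-odd = solve-∀

-- N is the alternating sum, in base B, of the coefficients of l with the
-- sign (-1)^(i-j) at position j.
AlternatingSum : ℕ → ℕ → List ℕ → ℕ → Set
AlternatingSum B i l N = (Even i → evenPart B l ≡ N + oddPart B l) × (Odd i → oddPart B l ≡ N + evenPart B l)

-- Multiplying by X - 1 = Y in base B = Y + 1: if E - O = N then
-- (O + E B) - (E + O B) = Y N.
alternating-step : ∀ Y N E O → E ≡ N + O → O + E * suc Y ≡ Y * N + (E + O * suc Y)
alternating-step Y N .(N + O) O refl = identity Y N O
  where
    identity : ∀ Y N O → O + (N + O) * suc Y ≡ Y * N + (N + O + O * suc Y)
    identity = solve-∀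

pascal-alternating : ∀ Y i → AlternatingSum (suc Y) i (pascal i) (Y ^ i)
pascal-alternating Y zero    = (λ _ → refl) , λ ()
pascal-alternating Y (suc i) =
    (λ odd  → trans (proj₁ next) (trans (alternating-step Y (Y ^ i) O E (proj₂ ih odd))  (cong (Y ^ suc i +_) (sym (proj₂ next)))))
  , (λ even → trans (proj₂ next) (trans (alternating-step Y (Y ^ i) E O (proj₁ ih even)) (cong (Y ^ suc i +_) (sym (proj₁ next)))))
  where
    E O : ℕ
    E = evenPart (suc Y) (pascal i)
    O = oddPart (suc Y) (pascal i)
    ih : AlternatingSum (suc Y) i (pascal i) (Y ^ i)
    ih = pascal-alternating Y i
    next : evenPart (suc Y) (pascal (suc i)) ≡ E + O * suc Y × oddPart (suc Y) (pascal (suc i)) ≡ O + E * suc Y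
    next = shiftSum-value (suc Y) 0 (pascal i)

module PowerDigitSum (c n : ℕ) (n≥1 : 1 ≤ n) where
  open BlockDigitSum c n n≥1 public

  Y : ℕ
  Y = B ∸ 1

  B≡1+Y : B ≡ suc Y
  B≡1+Y = sym (suc-pred B {{>-nonZero (≤-trans (s≤s z≤n) b≤B)}})

  1≤Y : 1 ≤ Y
  1≤Y = s≤s⁻¹ (subst (2 ≤_) B≡1+Y (≤-trans (s≤s (s≤s z≤n)) b≤B))

  -- s_b(Y) = W: Y consists of n digits b - 1.
  digitSum-Y : S Y ≡ W
  digitSum-Y = digitSum-complement n 0 Y (sym B≡1+Y)

  DigitSumMultiple : ℕ → Set
  DigitSumMultiple j = Σ ℕ λ u → Bounded (suc (suc j)) u × S (Y ^ suc j) ≡ u * W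

  -- Row j+1 of Pascal's triangle is a balanced list of digits whose
  -- alternating sum is Y^(j+1); its negative terms sit at the odd positions
  -- when j+1 is even and at the even positions when j+1 is odd.
  digitSum-power : ∀ j → 2 ^ suc j ≤ suc c → DigitSumMultiple j
  digitSum-power j small = [ lowest⁺ , lowest⁻ ]′ (parity (suc j))
    where
      row : List ℕ
      row = pascal (suc j)

      row-length : length row ≡ suc (suc j)
      row-length = pascal-length (suc j)

      digits : All (Bounded (suc c)) row
      digits = All.map (Bounded-mono small) (pascal-bounded (suc j))

      alternating : AlternatingSum B (suc j) row (Y ^ suc j)
      alternating = subst (λ B → AlternatingSum B (suc j) row (Y ^ suc j)) (sym B≡1+Y) (pascal-alternating Y (suc j))

      counts : Bounded (suc (suc j)) (evenCount row) × Bounded (suc (suc j)) (oddCount row)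
      counts = subst (λ m → Bounded m (evenCount row) × Bounded m (oddCount row)) row-length
        (counts-bounded row (subst (2 ≤_) (sym row-length) (s≤s (s≤s z≤n))))

      lowest⁺ : Even (suc j) → DigitSumMultiple j
      lowest⁺ even = oddCount row , proj₂ counts ,
        digitSum-alternating⁺ (Y ^ suc j) row (subst Odd (sym row-length) even) digits (pascal-balanced j) (proj₁ alternating even)

      lowest⁻ : Odd (suc j) → DigitSumMultiple j
      lowest⁻ odd = evenCount row , proj₁ counts ,
        digitSum-alternating⁻ (Y ^ suc j) row (subst Even (sym row-length) odd) digits (pascal-balanced j) (proj₂ alternating odd)

-- (1 + 2e)^(2^k) ≡ 1 modulo 2^k·2e: each squaring doubles the modulus.
oddPower-congruence : ∀ e k → Σ ℕ λ q → suc (2 * e) ^ 2 ^ k ≡ suc (2 ^ k * (2 * e) * q)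
oddPower-congruence e zero    = 1 , first-power e
  where
    first-power : ∀ e → suc (2 * e) * 1 ≡ suc (1 * (2 * e) * 1)
    first-power = solve-∀
oddPower-congruence e (suc k) with oddPower-congruence e k
... | q , congruence = q + 2 ^ k * e * q * q , (begin
    A ^ (2 ^ k + (2 ^ k + 0))          ≡⟨ ^-distribˡ-+-* A (2 ^ k) (2 ^ k + 0) ⟩
    A ^ 2 ^ k * A ^ (2 ^ k + 0)        ≡⟨ cong (λ t → A ^ 2 ^ k * A ^ t) (+-identityʳ (2 ^ k)) ⟩
    A ^ 2 ^ k * A ^ 2 ^ k              ≡⟨ cong (λ t → t * t) congruence ⟩
    suc (2 ^ k * (2 * e) * q) * suc (2 ^ k * (2 * e) * q)
                                       ≡⟨ square (2 ^ k) e q ⟩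
    suc (2 * 2 ^ k * (2 * e) * (q + 2 ^ k * e * q * q)) ∎)
  where
    open ≡-Reasoning
    A : ℕ
    A = suc (2 * e)
    square : ∀ P e q → suc (P * (2 * e) * q) * suc (P * (2 * e) * q) ≡ suc (2 * P * (2 * e) * (q + P * e * q * q))
    square = solve-∀

period-divides : ∀ e k → 2 ^ k * (2 * e) ∣ suc (2 * e) ^ 2 ^ k ∸ 1
period-divides e k with oddPower-congruence e k
... | q , congruence = divides q (trans (cong (_∸ 1) congruence) (*-comm (2 ^ k * (2 * e)) q))

∣-factorial : ∀ {m u} → Bounded m u → u ∣ m !
∣-factorial {u = suc u} (_ , u<m) = ∣-trans (m∣m*n (u !)) (m≤n⇒m!∣n! u<m)

scaled-divides-power : ∀ {u W Y} j → u ∣ W → W ∣ Y → u * W ∣ Y ^ suc (suc j)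
scaled-divides-power {W = W} {Y = Y} j u∣W W∣Y =
  ∣-trans (*-monoˡ-∣ W u∣W) (∣-trans (*-pres-∣ W∣Y W∣Y) (*-monoʳ-∣ Y (m∣m*n (Y ^ j))))

niven-base : ∀ c d e → suc c ≡ 2 * e → (∀ u → Bounded (suc d) u → u ∣ suc c) → 2 ^ d ≤ suc c →
  ∀ k i → 1 ≤ i → i ≤ d → IsNivenDeg i (suc (suc c)) (suc (suc c) ^ (2 ^ k) ∸ 1)
niven-base c d e b-1≡2e divisors small k i 1≤i i≤d =
    (1≤Y , Y-niven) , (m^n>0 Y {{>-nonZero 1≤Y}} i , power-niven i 1≤i i≤d)
  where
    open PowerDigitSum c (2 ^ k) (m^n>0 2 k)

    W∣Y : W ∣ Y
    W∣Y = subst (λ m → 2 ^ k * m ∣ suc m ^ 2 ^ k ∸ 1) (sym b-1≡2e) (period-divides e k)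

    Y-niven : S Y ∣ Y
    Y-niven = subst (_∣ Y) (sym digitSum-Y) W∣Y

    power-niven : ∀ i → 1 ≤ i → i ≤ d → S (Y ^ i) ∣ Y ^ i
    power-niven zero          () _
    power-niven (suc zero)    _ _ = subst (λ t → S t ∣ t) (sym (*-identityʳ Y)) Y-niven
    power-niven (suc (suc j)) _ i≤d with digitSum-power (suc j) (≤-trans (^-monoʳ-≤ 2 i≤d) small)
    ... | u , u≤i+1 , S≡uW = subst (_∣ Y ^ suc (suc j)) (sym S≡uW)
          (scaled-divides-power j (∣-trans (divisors u (Bounded-mono (s≤s i≤d) u≤i+1)) (n∣m*n (2 ^ k))) W∣Y)

-- The bases b = 2e + 1 with e = (d+1)!·(M + 2^d + 1) satisfy the
-- conditions of niven-base and exceed M.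
theorem3 : (d : ℕ) → 1 ≤ d →
    (M : ℕ) → Σ ℕ (λ b → M ≤ b × 2 ≤ b ×
      ((k i : ℕ) → 1 ≤ k → 1 ≤ i → i ≤ d →
        IsNivenDeg i b (b ^ (2 ^ k) ∸ 1)))
theorem3 d _ M = suc (suc c) , M≤b , s≤s (s≤s z≤n) , λ k i _ → niven-base c d e b-1≡2e divisors 2^d≤b-1 k i
  where
    K e c : ℕ
    K = suc (M + 2 ^ d)
    e = suc d ! * K
    c = pred (2 * e)

    K≤2e : K ≤ 2 * e
    K≤2e = ≤-trans (m≤n*m K (suc d !) {{suc d !≢0}}) (m≤m+n e (e + 0))

    b-1≡2e : suc c ≡ 2 * e
    b-1≡2e = suc-pred (2 * e) {{>-nonZero (≤-trans (s≤s z≤n) K≤2e)}}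

    K≤b-1 : K ≤ suc c
    K≤b-1 = subst (K ≤_) (sym b-1≡2e) K≤2e

    M≤b : M ≤ suc (suc c)
    M≤b = ≤-trans (m≤m+n M (2 ^ d)) (≤-trans (n≤1+n _) (≤-trans K≤b-1 (n≤1+n (suc c))))

    2^d≤b-1 : 2 ^ d ≤ suc c
    2^d≤b-1 = ≤-trans (m≤n+m (2 ^ d) M) (≤-trans (n≤1+n _) K≤b-1)

    divisors : ∀ u → Bounded (suc d) u → u ∣ suc c
    divisors u u≤d+1 = subst (u ∣_) (sym b-1≡2e) (∣-trans (∣-factorial u≤d+1) (∣-trans (m∣m*n K) (n∣m*n 2)))
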